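{- Let $n\ge 2$ be an integer and $m=3n$. Let $\Gamma_{m}=\{z\in \mathbb{Z}_3^{m} : \sum_{i=1}^m z_i \equiv 0 \pmod 3\}$, for distinct $i,j\in\{1,\dots,m\}$ let $x_{i,j}\in\mathbb{Z}_3^m$ have $i$th coordinate $1$, $j$th coordinate $2$ and all other coordinates $0$, let $X_m=\{x_{i,j}: i\ne j\}$, and let $G_m$ be the graph on $\Gamma_m$ with $y\sim z$ adjacent iff $y-z\in X_m$. Let $\mathbf{a}=(1,1,\dots,1)$, $\mathbf{b}=(2,2,\dots,2)\in\mathbb{Z}_3^{3n}$, and define the equivalence relation $y\approx z$ iff $y-z\in\{\mathbf{0},\mathbf{a},\mathbf{b}\}$ on $\Gamma_{3n}$, whose classes are $\{y,y+\mathbf{a},y+\mathbf{b}\}$. Then $G_{3n}^{2n-1}$ is the complete multipartite graph $K_{3\star 3^{3n-2}}$ whose partite sets are exactly these equivalence classes.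
   Context: For a graph $G$ and positive integer $k$, $G^k$ is the graph on $V(G)$ in which distinct $u,v$ are adjacent iff their distance in $G$ is at most $k$. $K_{n\star r}$ denotes the complete multipartite graph with $r$ partite sets each of size $n$. -}

module Defs where

open import Data.Nat using (ℕ; zero; suc; _+_; _∸_; _≤_)
open import Data.Nat.DivMod using (_mod_)
open import Data.Fin using (Fin; toℕ; _≟_)
open import Data.Vec using (Vec; zipWith; map; sum; tabulate; replicate)
open import Data.Bool using (if_then_else_)
open import Data.Product using (Σ; ∃; _×_; ∃-syntax)
open import Data.Sum using (_⊎_)
open import Relation.Nullary using (¬_; does)
open import Relation.Binary.PropositionalEquality using (_≡_; _≢_)

Z3 : Set
Z3 = Fin 3

_⊕_ : Z3 → Z3 → Z3
a ⊕ b = (toℕ a + toℕ b) mod 3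

_⊖_ : Z3 → Z3 → Z3
a ⊖ b = (toℕ a + (3 ∸ toℕ b)) mod 3

Vm : ℕ → Set
Vm m = Vec Z3 m

_-ᵥ_ : ∀ {m} → Vm m → Vm m → Vm m
y -ᵥ z = zipWith _⊖_ y z

InΓ : ∀ {m} → Vm m → Set
InΓ y = sum (map toℕ y) mod 3 ≡ Data.Fin.zero

x : ∀ {m} → Fin m → Fin m → Vm m
x i j = tabulate λ k → if does (k ≟ i) then Data.Fin.suc Data.Fin.zero
                       else if does (k ≟ j) then Data.Fin.suc (Data.Fin.suc Data.Fin.zero)
                       else Data.Fin.zero

InX : ∀ {m} → Vm m → Set
InX {m} d = ∃[ i ] ∃[ j ] (i ≢ j × d ≡ x {m} i j)

Adj : ∀ {m} → Vm m → Vm m → Set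
Adj y z = InΓ y × InΓ z × InX (y -ᵥ z)

data Walk {m} : Vm m → Vm m → ℕ → Set where
  here : ∀ {y} → Walk y y zero
  step : ∀ {y w z l} → Adj y w → Walk w z l → Walk y z (suc l)

DistLe : ∀ {m} → ℕ → Vm m → Vm m → Set
DistLe {m} k y z = ∃[ l ] (l ≤ k × Walk {m} y z l)

AdjPow : ∀ {m} → ℕ → Vm m → Vm m → Set
AdjPow k y z = y ≢ z × DistLe k y z

𝐚 𝐛 : ∀ {m} → Vm m
𝐚 = replicate _ (Data.Fin.suc Data.Fin.zero)
𝐛 = replicate _ (Data.Fin.suc (Data.Fin.suc Data.Fin.zero))

𝟎 : ∀ {m} → Vm m
𝟎 = replicate _ Data.Fin.zero

_≈_ : ∀ {m} → Vm m → Vm m → Set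
y ≈ z = (y -ᵥ z ≡ 𝟎) ⊎ (y -ᵥ z ≡ 𝐚) ⊎ (y -ᵥ z ≡ 𝐛)

{-# OPTIONS --safe #-}
module Submission where

-- Write d = y − z.  A walk of length l from y to z amounts to writing d as a sum of l
-- generators x i j; the intermediate vertices then lie in Γ automatically.  Read in ℕ, the
-- coordinate sums w₁ d of −d and w₂ d of d drop by at most 3 per generator, while
-- w₁ a = w₂ b = 6n > 3(2n − 1); so no class {y, y + a, y + b} contains an edge of the power
-- graph.  Conversely, for d ∈ Γ outside {0, a, b} both sums are multiples of 3 below 6n,
-- hence at most 3(2n − 1); and if both sums of a nonzero d ∈ Γ are at most 3k, then some
-- d − x i j has both at most 3(k − 1): take d i = 1 and d j = 2 if possible, and otherwise
-- two equal nonzero entries (d ∈ Γ then has at least three of them).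

open import Defs
open import Data.Nat using (ℕ; zero; suc; pred; _+_; _*_; _∸_; _≤_; _<_; z≤n; s≤s; _≤?_; _<?_)
open import Data.Nat.Properties hiding (_≟_)
open import Data.Empty using (⊥-elim)
open import Data.Nat.DivMod using (_mod_; _%_; %-distribˡ-+; m%n%n≡m%n)
open import Data.Nat.Divisibility using (_∣_; divides; ∣m+n∣m⇒∣n; m%n≡0⇒n∣m)
open import Data.Nat.Solver using (module +-*-Solver)
open import Data.Fin using (Fin; toℕ) renaming (zero to fzero; suc to fsuc)
open import Data.Fin.Properties using (all?; _≟_; toℕ-injective; toℕ-fromℕ<)
  renaming (suc-injective to fsuc-injective)
open import Data.Vec using (Vec; []; _∷_; lookup; tabulate; replicate; map; sum; count)
open import Data.Vec.Properties using (∷-injectiveˡ; ∷-injectiveʳ)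
open import Data.Bool using (if_then_else_)
open import Data.Product using (_×_; _,_; proj₁; ∃-syntax)
open import Data.Sum using (inj₁; inj₂)
open import Function using (_∘_)
open import Relation.Nullary using (¬_; does; yes; no)
open import Relation.Nullary.Decidable using (True; toWitness; ¬?; _→-dec_)
open import Relation.Unary using (Pred; Decidable)
open import Relation.Binary.PropositionalEquality
  using (_≡_; _≢_; refl; sym; trans; cong; cong₂; subst; module ≡-Reasoning)

open +-*-Solver using (solve; con; _:+_; _:*_; _:=_)

pattern 0₃ = fzero
pattern 1₃ = fsuc fzero
pattern 2₃ = fsuc (fsuc fzero)

by-exhaustion : ∀ {p} {P : Z3 → Set p} (P? : Decidable P) {holds : True (all? P?)} → ∀ a → P a
by-exhaustion P? {holds} = toWitness holds

a⊖a≡0 : ∀ a → a ⊖ a ≡ 0₃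
a⊖a≡0 = by-exhaustion λ a → _ ≟ _

a⊖b≡0⇒a≡b : ∀ a b → a ⊖ b ≡ 0₃ → a ≡ b
a⊖b≡0⇒a≡b = by-exhaustion λ a → all? λ b → (_ ≟ _) →-dec (_ ≟ _)

a⊖0≡a : ∀ a → a ⊖ 0₃ ≡ a
a⊖0≡a = by-exhaustion λ a → _ ≟ _

a⊕0≡a : ∀ a → a ⊕ 0₃ ≡ a
a⊕0≡a = by-exhaustion λ a → _ ≟ _

0⊕a≡a : ∀ a → 0₃ ⊕ a ≡ a
0⊕a≡a = by-exhaustion λ a → _ ≟ _

a⊖[a⊖b]≡b : ∀ a b → a ⊖ (a ⊖ b) ≡ b
a⊖[a⊖b]≡b = by-exhaustion λ a → all? λ b → _ ≟ _

[a⊖c]⊖[a⊖b]≡b⊖c : ∀ a b c → (a ⊖ c) ⊖ (a ⊖ b) ≡ b ⊖ c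
[a⊖c]⊖[a⊖b]≡b⊖c = by-exhaustion λ a → all? λ b → all? λ c → _ ≟ _

[a⊖b]⊖c≡[a⊖c]⊖b : ∀ a b c → (a ⊖ b) ⊖ c ≡ (a ⊖ c) ⊖ b
[a⊖b]⊖c≡[a⊖c]⊖b = by-exhaustion λ a → all? λ b → all? λ c → _ ≟ _

[a⊖b]⊕[c⊖d]≡[a⊕c]⊖[b⊕d] : ∀ a b c d → (a ⊖ b) ⊕ (c ⊖ d) ≡ (a ⊕ c) ⊖ (b ⊕ d)
[a⊖b]⊕[c⊖d]≡[a⊕c]⊖[b⊕d] = by-exhaustion λ a → all? λ b → all? λ c → all? λ d → _ ≟ _

u-ᵥu≡𝟎 : ∀ {m} (u : Vm m) → u -ᵥ u ≡ 𝟎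
u-ᵥu≡𝟎 []      = refl
u-ᵥu≡𝟎 (a ∷ u) = cong₂ _∷_ (a⊖a≡0 a) (u-ᵥu≡𝟎 u)

u-ᵥv≡𝟎⇒u≡v : ∀ {m} (u v : Vm m) → u -ᵥ v ≡ 𝟎 → u ≡ v
u-ᵥv≡𝟎⇒u≡v []      []      _  = refl
u-ᵥv≡𝟎⇒u≡v (a ∷ u) (b ∷ v) eq =
  cong₂ _∷_ (a⊖b≡0⇒a≡b a b (∷-injectiveˡ eq)) (u-ᵥv≡𝟎⇒u≡v u v (∷-injectiveʳ eq))

u-ᵥ[u-ᵥv]≡v : ∀ {m} (u v : Vm m) → u -ᵥ (u -ᵥ v) ≡ v
u-ᵥ[u-ᵥv]≡v []      []      = refl
u-ᵥ[u-ᵥv]≡v (a ∷ u) (b ∷ v) = cong₂ _∷_ (a⊖[a⊖b]≡b a b) (u-ᵥ[u-ᵥv]≡v u v)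

[u-ᵥw]-ᵥ[u-ᵥv]≡v-ᵥw : ∀ {m} (u v w : Vm m) → (u -ᵥ w) -ᵥ (u -ᵥ v) ≡ v -ᵥ w
[u-ᵥw]-ᵥ[u-ᵥv]≡v-ᵥw []      []      []      = refl
[u-ᵥw]-ᵥ[u-ᵥv]≡v-ᵥw (a ∷ u) (b ∷ v) (c ∷ w) =
  cong₂ _∷_ ([a⊖c]⊖[a⊖b]≡b⊖c a b c) ([u-ᵥw]-ᵥ[u-ᵥv]≡v-ᵥw u v w)

[u-ᵥv]-ᵥw≡[u-ᵥw]-ᵥv : ∀ {m} (u v w : Vm m) → (u -ᵥ v) -ᵥ w ≡ (u -ᵥ w) -ᵥ v
[u-ᵥv]-ᵥw≡[u-ᵥw]-ᵥv []      []      []      = refl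
[u-ᵥv]-ᵥw≡[u-ᵥw]-ᵥv (a ∷ u) (b ∷ v) (c ∷ w) =
  cong₂ _∷_ ([a⊖b]⊖c≡[a⊖c]⊖b a b c) ([u-ᵥv]-ᵥw≡[u-ᵥw]-ᵥv u v w)

u-ᵥzeros≡u : ∀ {m} (u : Vm m) → u -ᵥ tabulate (λ _ → 0₃) ≡ u
u-ᵥzeros≡u []      = refl
u-ᵥzeros≡u (a ∷ u) = cong₂ _∷_ (a⊖0≡a a) (u-ᵥzeros≡u u)

-- Chosen so that the tail of x i j is definitionally a vector of this form.
single : ∀ {m} → Fin m → Z3 → Vm m
single j c = tabulate λ k → if does (k ≟ j) then c else 0₃

sum₃ : ∀ {m} → Vm m → Z3
sum₃ []      = 0₃
sum₃ (a ∷ v) = a ⊕ sum₃ v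

sum₃-zeros : ∀ {m} → sum₃ (tabulate {m} λ _ → 0₃) ≡ 0₃
sum₃-zeros {zero}  = refl
sum₃-zeros {suc m} = cong (0₃ ⊕_) (sum₃-zeros {m})

sum₃-single : ∀ {m} (j : Fin m) c → sum₃ (single j c) ≡ c
sum₃-single {suc m} fzero    c = trans (cong (c ⊕_) (sum₃-zeros {m})) (a⊕0≡a c)
sum₃-single         (fsuc j) c = trans (cong (0₃ ⊕_) (sum₃-single j c)) (0⊕a≡a c)

sum₃-x : ∀ {m} {i j : Fin m} → i ≢ j → sum₃ (x i j) ≡ 0₃
sum₃-x {i = fzero}  {fzero}  i≢j = ⊥-elim (i≢j refl)
sum₃-x {i = fzero}  {fsuc j} _   = cong (1₃ ⊕_) (sum₃-single j 2₃)
sum₃-x {i = fsuc i} {fzero}  _   = cong (2₃ ⊕_) (sum₃-single i 1₃)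
sum₃-x {i = fsuc i} {fsuc j} i≢j = cong (0₃ ⊕_) (sum₃-x (i≢j ∘ cong fsuc))

sum₃-[-ᵥ] : ∀ {m} (u v : Vm m) → sum₃ (u -ᵥ v) ≡ sum₃ u ⊖ sum₃ v
sum₃-[-ᵥ] []      []      = refl
sum₃-[-ᵥ] (a ∷ u) (b ∷ v) =
  trans (cong ((a ⊖ b) ⊕_) (sum₃-[-ᵥ] u v)) ([a⊖b]⊕[c⊖d]≡[a⊕c]⊖[b⊕d] a b (sum₃ u) (sum₃ v))

[a+s]mod3≡[a+s%3]mod3 : ∀ a s → (a + s) mod 3 ≡ (a + toℕ (s mod 3)) mod 3
[a+s]mod3≡[a+s%3]mod3 a s = toℕ-injective (begin
  toℕ ((a + s) mod 3)               ≡⟨ toℕ-fromℕ< _ ⟩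
  (a + s) % 3                       ≡⟨ %-distribˡ-+ a s 3 ⟩
  (a % 3 + s % 3) % 3               ≡⟨ cong (λ t → (a % 3 + t) % 3) (m%n%n≡m%n s 3) ⟨
  (a % 3 + s % 3 % 3) % 3           ≡⟨ %-distribˡ-+ a (s % 3) 3 ⟨
  (a + s % 3) % 3                   ≡⟨ cong (λ t → (a + t) % 3) (toℕ-fromℕ< _) ⟨
  (a + toℕ (s mod 3)) % 3           ≡⟨ toℕ-fromℕ< _ ⟨
  toℕ ((a + toℕ (s mod 3)) mod 3)   ∎)
  where open ≡-Reasoning

sum-mod3≡sum₃ : ∀ {m} (v : Vm m) → sum (map toℕ v) mod 3 ≡ sum₃ v
sum-mod3≡sum₃ []      = refl
sum-mod3≡sum₃ (a ∷ v) =
  trans ([a+s]mod3≡[a+s%3]mod3 (toℕ a) _) (cong (λ t → (toℕ a + toℕ t) mod 3) (sum-mod3≡sum₃ v))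

Γ-[-ᵥ] : ∀ {m} (u v : Vm m) → InΓ u → InΓ v → InΓ (u -ᵥ v)
Γ-[-ᵥ] u v Γu Γv = begin
  sum (map toℕ (u -ᵥ v)) mod 3   ≡⟨ sum-mod3≡sum₃ (u -ᵥ v) ⟩
  sum₃ (u -ᵥ v)                  ≡⟨ sum₃-[-ᵥ] u v ⟩
  sum₃ u ⊖ sum₃ v                ≡⟨ cong₂ _⊖_ (trans (sym (sum-mod3≡sum₃ u)) Γu) (trans (sym (sum-mod3≡sum₃ v)) Γv) ⟩
  0₃                             ∎
  where open ≡-Reasoning

Γ-[-ᵥx] : ∀ {m} (v : Vm m) {i j} → InΓ v → i ≢ j → InΓ (v -ᵥ x i j)
Γ-[-ᵥx] v {i} {j} Γv i≢j = Γ-[-ᵥ] v (x i j) Γv (trans (sum-mod3≡sum₃ (x i j)) (sum₃-x i≢j))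

data XSum {m} : ℕ → Vm m → Set where
  []  : XSum 0 𝟎
  _∷_ : ∀ {l d i j} → i ≢ j → XSum l (d -ᵥ x i j) → XSum (suc l) d

walk⇒xsum : ∀ {m} {y z : Vm m} {l} → Walk y z l → XSum l (y -ᵥ z)
walk⇒xsum {y = y} here = subst (XSum 0) (sym (u-ᵥu≡𝟎 y)) []
walk⇒xsum {y = y} {z} (step {w = w} (_ , _ , i , j , i≢j , y-w≡xij) walk) =
  i≢j ∷ subst (XSum _) w-z≡d-xij (walk⇒xsum walk)
  where
    w-z≡d-xij : w -ᵥ z ≡ (y -ᵥ z) -ᵥ x i j
    w-z≡d-xij = trans (sym ([u-ᵥw]-ᵥ[u-ᵥv]≡v-ᵥw y w z)) (cong ((y -ᵥ z) -ᵥ_) y-w≡xij)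

xsum⇒walk : ∀ {m} {y z d : Vm m} {l} → InΓ y → InΓ z → XSum l d → y -ᵥ z ≡ d → Walk y z l
xsum⇒walk {y = y} {z} _ _ [] y-z≡𝟎 = subst (λ v → Walk y v 0) (u-ᵥv≡𝟎⇒u≡v y z y-z≡𝟎) here
xsum⇒walk {y = y} {z} {d} Γy Γz (_∷_ {i = i} {j} i≢j s) y-z≡d =
  step (Γy , Γw , i , j , i≢j , u-ᵥ[u-ᵥv]≡v y (x i j)) (xsum⇒walk Γw Γz s w-z≡d-xij)
  where
    Γw : InΓ (y -ᵥ x i j)
    Γw = Γ-[-ᵥx] y Γy i≢j

    w-z≡d-xij : (y -ᵥ x i j) -ᵥ z ≡ d -ᵥ x i j
    w-z≡d-xij = trans ([u-ᵥv]-ᵥw≡[u-ᵥw]-ᵥv y (x i j) z) (cong (_-ᵥ x i j) y-z≡d)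

weight : (Z3 → ℕ) → ∀ {m} → Vm m → ℕ
weight w v = sum (map w v)

w₁ w₂ : Z3 → ℕ
w₁ a = toℕ (0₃ ⊖ a)
w₂   = toℕ

StepBounded : (Z3 → ℕ) → Set
StepBounded w = ∀ a b → w a + w b ≤ 3 + (w (a ⊖ 1₃) + w (b ⊖ 2₃))

w₁-step-bounded : StepBounded w₁
w₁-step-bounded = by-exhaustion λ a → all? λ b → _ ≤? _

w₂-step-bounded : StepBounded w₂
w₂-step-bounded = by-exhaustion λ a → all? λ b → _ ≤? _

w₁<w₁1 : ∀ a → a ≢ 1₃ → w₁ a < w₁ 1₃
w₁<w₁1 = by-exhaustion λ a → ¬? (_ ≟ _) →-dec (_ <? _)

w₂<w₂2 : ∀ a → a ≢ 2₃ → w₂ a < w₂ 2₃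
w₂<w₂2 = by-exhaustion λ a → ¬? (_ ≟ _) →-dec (_ <? _)

weight-replicate : ∀ (w : Z3 → ℕ) m c → weight w (replicate m c) ≡ m * w c
weight-replicate w zero    c = refl
weight-replicate w (suc m) c = cong (w c +_) (weight-replicate w m c)

weight<*max : ∀ (w : Z3 → ℕ) c → (∀ a → a ≢ c → w a < w c) →
              ∀ {m} (v : Vm m) → v ≢ replicate m c → weight w v < m * w c
weight<*max w c max []      v≢c = ⊥-elim (v≢c refl)
weight<*max w c max (a ∷ v) v≢c with a ≟ c
... | yes refl = +-monoʳ-< (w c) (weight<*max w c max v (v≢c ∘ cong (c ∷_)))
... | no  a≢c  = +-mono-<-≤ (max a a≢c) (weight≤*max v)
  where
    w≤wc : ∀ b → w b ≤ w c
    w≤wc b with b ≟ c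
    ... | yes refl = ≤-refl
    ... | no  b≢c  = <⇒≤ (max b b≢c)

    weight≤*max : ∀ {m} (v : Vm m) → weight w v ≤ m * w c
    weight≤*max []      = z≤n
    weight≤*max (b ∷ v) = +-mono-≤ (w≤wc b) (weight≤*max v)

+-exchange : ∀ A B {P Q q r : ℕ} → P + q ≡ Q + r → (A + P) + (B + q) ≡ (B + Q) + (A + r)
+-exchange A B {P} {Q} {q} {r} P+q≡Q+r = begin
  (A + P) + (B + q)  ≡⟨ solve 4 (λ A B P q → (A :+ P) :+ (B :+ q) := (A :+ B) :+ (P :+ q)) refl A B P q ⟩
  (A + B) + (P + q)  ≡⟨ cong ((A + B) +_) P+q≡Q+r ⟩
  (A + B) + (Q + r)  ≡⟨ solve 4 (λ A B Q r → (A :+ B) :+ (Q :+ r) := (B :+ Q) :+ (A :+ r)) refl A B Q r ⟩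
  (B + Q) + (A + r)  ∎
  where open ≡-Reasoning

weight-[-ᵥsingle] : ∀ (w : Z3 → ℕ) {m} (v : Vm m) j c →
                    weight w (v -ᵥ single j c) + w (lookup v j) ≡ weight w v + w (lookup v j ⊖ c)
weight-[-ᵥsingle] w (a ∷ v) fzero c = begin
  w (a ⊖ c) + weight w (v -ᵥ tabulate (λ _ → 0₃)) + w a  ≡⟨ cong (λ t → w (a ⊖ c) + weight w t + w a) (u-ᵥzeros≡u v) ⟩
  w (a ⊖ c) + weight w v + w a                          ≡⟨ solve 3 (λ A V B → A :+ V :+ B := B :+ V :+ A) refl (w (a ⊖ c)) (weight w v) (w a) ⟩
  w a + weight w v + w (a ⊖ c)                          ∎
  where open ≡-Reasoning
weight-[-ᵥsingle] w (a ∷ v) (fsuc j) c = begin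
  w (a ⊖ 0₃) + weight w (v -ᵥ single j c) + w (lookup v j)  ≡⟨ cong (λ b → w b + _ + _) (a⊖0≡a a) ⟩
  w a + weight w (v -ᵥ single j c) + w (lookup v j)         ≡⟨ +-assoc (w a) _ _ ⟩
  w a + (weight w (v -ᵥ single j c) + w (lookup v j))       ≡⟨ cong (w a +_) (weight-[-ᵥsingle] w v j c) ⟩
  w a + (weight w v + w (lookup v j ⊖ c))                   ≡⟨ +-assoc (w a) _ _ ⟨
  w a + weight w v + w (lookup v j ⊖ c)                     ∎
  where open ≡-Reasoning

weight-[-ᵥx] : ∀ (w : Z3 → ℕ) {m} (v : Vm m) {i j} → i ≢ j →
               weight w (v -ᵥ x i j) + (w (lookup v i) + w (lookup v j))
               ≡ weight w v + (w (lookup v i ⊖ 1₃) + w (lookup v j ⊖ 2₃))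
weight-[-ᵥx] w (a ∷ v) {fzero}  {fzero}  i≢j = ⊥-elim (i≢j refl)
weight-[-ᵥx] w (a ∷ v) {fzero}  {fsuc j} _   = +-exchange (w (a ⊖ 1₃)) (w a) (weight-[-ᵥsingle] w v j 2₃)
weight-[-ᵥx] w (a ∷ v) {fsuc i} {fzero}  _   = begin
  w (a ⊖ 2₃) + weight w (v -ᵥ single i 1₃) + (w (lookup v i) + w a)
    ≡⟨ cong (w (a ⊖ 2₃) + weight w (v -ᵥ single i 1₃) +_) (+-comm (w (lookup v i)) (w a)) ⟩
  w (a ⊖ 2₃) + weight w (v -ᵥ single i 1₃) + (w a + w (lookup v i))  ≡⟨ +-exchange (w (a ⊖ 2₃)) (w a) (weight-[-ᵥsingle] w v i 1₃) ⟩
  w a + weight w v + (w (a ⊖ 2₃) + w (lookup v i ⊖ 1₃))               ≡⟨ cong (w a + weight w v +_) (+-comm (w (a ⊖ 2₃)) _) ⟩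
  w a + weight w v + (w (lookup v i ⊖ 1₃) + w (a ⊖ 2₃))               ∎
  where open ≡-Reasoning
weight-[-ᵥx] w (a ∷ v) {fsuc i} {fsuc j} i≢j = begin
  w (a ⊖ 0₃) + weight w (v -ᵥ x i j) + (w (lookup v i) + w (lookup v j))  ≡⟨ cong (λ b → w b + _ + _) (a⊖0≡a a) ⟩
  w a + weight w (v -ᵥ x i j) + (w (lookup v i) + w (lookup v j))         ≡⟨ +-assoc (w a) _ _ ⟩
  w a + (weight w (v -ᵥ x i j) + (w (lookup v i) + w (lookup v j)))       ≡⟨ cong (w a +_) (weight-[-ᵥx] w v (i≢j ∘ cong fsuc)) ⟩
  w a + (weight w v + (w (lookup v i ⊖ 1₃) + w (lookup v j ⊖ 2₃)))        ≡⟨ +-assoc (w a) _ _ ⟨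
  w a + weight w v + (w (lookup v i ⊖ 1₃) + w (lookup v j ⊖ 2₃))          ∎
  where open ≡-Reasoning

weight-xsum≤ : ∀ (w : Z3 → ℕ) → w 0₃ ≡ 0 → StepBounded w →
               ∀ {m l} {d : Vm m} → XSum l d → weight w d ≤ 3 * l
weight-xsum≤ w w0≡0 _ {m} [] = ≤-reflexive (begin
  weight w (replicate m 0₃)  ≡⟨ weight-replicate w m 0₃ ⟩
  m * w 0₃                   ≡⟨ cong (m *_) w0≡0 ⟩
  m * 0                      ≡⟨ *-zeroʳ m ⟩
  0                          ∎)
  where open ≡-Reasoning
weight-xsum≤ w w0≡0 bounded {d = d} (_∷_ {l = l} {i = i} {j} i≢j s) =
  +-cancelʳ-≤ B (weight w d) (3 * suc l) (begin
    weight w d + B             ≡⟨ weight-[-ᵥx] w d i≢j ⟨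
    weight w (d -ᵥ x i j) + A  ≤⟨ +-mono-≤ (weight-xsum≤ w w0≡0 bounded s) (bounded _ _) ⟩
    3 * l + (3 + B)            ≡⟨ +-assoc (3 * l) 3 B ⟨
    3 * l + 3 + B              ≡⟨ cong (_+ B) (+-comm (3 * l) 3) ⟩
    3 + 3 * l + B              ≡⟨ cong (_+ B) (*-suc 3 l) ⟨
    3 * suc l + B              ∎)
  where
    open ≤-Reasoning
    A B : ℕ
    A = w (lookup d i) + w (lookup d j)
    B = w (lookup d i ⊖ 1₃) + w (lookup d j ⊖ 2₃)

module _ {a p} {A : Set a} {P : Pred A p} (P? : Decidable P) where

  count≡suc⇒∃ : ∀ {n k} (xs : Vec A n) → count P? xs ≡ suc k → ∃[ i ] P (lookup xs i)
  count≡suc⇒∃ []       ()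
  count≡suc⇒∃ (y ∷ ys) c with P? y
  ... | yes py = fzero , py
  ... | no  _  = let i , pi = count≡suc⇒∃ ys c in fsuc i , pi

  count≡2+⇒∃₂ : ∀ {n k} (xs : Vec A n) → count P? xs ≡ suc (suc k) →
                ∃[ i ] ∃[ j ] (i ≢ j × P (lookup xs i) × P (lookup xs j))
  count≡2+⇒∃₂ []       ()
  count≡2+⇒∃₂ (y ∷ ys) c with P? y
  ... | yes py = let j , pj = count≡suc⇒∃ ys (suc-injective c) in fzero , fsuc j , (λ ()) , py , pj
  ... | no  _  = let i , j , i≢j , pi , pj = count≡2+⇒∃₂ ys c in
                 fsuc i , fsuc j , i≢j ∘ fsuc-injective , pi , pj

occurrences : ∀ {m} → Z3 → Vm m → ℕ
occurrences c = count (_≟ c)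

weight≡occurrences : ∀ (w : Z3 → ℕ) → w 0₃ ≡ 0 → ∀ {m} (v : Vm m) →
                     weight w v ≡ w 1₃ * occurrences 1₃ v + w 2₃ * occurrences 2₃ v
weight≡occurrences w _     []       = sym (cong₂ _+_ (*-zeroʳ (w 1₃)) (*-zeroʳ (w 2₃)))
weight≡occurrences w w0≡0 (0₃ ∷ v) = trans (cong (_+ weight w v) w0≡0) (weight≡occurrences w w0≡0 v)
weight≡occurrences w w0≡0 (1₃ ∷ v) = trans (cong (w 1₃ +_) (weight≡occurrences w w0≡0 v))
  (solve 4 (λ a b p q → a :+ (a :* p :+ b :* q) := a :* (con 1 :+ p) :+ b :* q) refl
         (w 1₃) (w 2₃) (occurrences 1₃ v) (occurrences 2₃ v))
weight≡occurrences w w0≡0 (2₃ ∷ v) = trans (cong (w 2₃ +_) (weight≡occurrences w w0≡0 v))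
  (solve 4 (λ a b p q → b :+ (a :* p :+ b :* q) := a :* p :+ b :* (con 1 :+ q)) refl
         (w 1₃) (w 2₃) (occurrences 1₃ v) (occurrences 2₃ v))

weight-w₁≡0⇒𝟎 : ∀ {m} (v : Vm m) → weight w₁ v ≡ 0 → v ≡ 𝟎
weight-w₁≡0⇒𝟎 []       _  = refl
weight-w₁≡0⇒𝟎 (0₃ ∷ v) w≡0 = cong (0₃ ∷_) (weight-w₁≡0⇒𝟎 v w≡0)
weight-w₁≡0⇒𝟎 (1₃ ∷ v) ()
weight-w₁≡0⇒𝟎 (2₃ ∷ v) ()

Γ⇒3∣weight-w₂ : ∀ {m} (v : Vm m) → InΓ v → 3 ∣ weight w₂ v
Γ⇒3∣weight-w₂ _ Γv = m%n≡0⇒n∣m _ 3 (trans (sym (toℕ-fromℕ< _)) (cong toℕ Γv))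

Γ⇒3∣weight-w₁ : ∀ {m} (v : Vm m) → InΓ v → 3 ∣ weight w₁ v
Γ⇒3∣weight-w₁ v Γv = ∣m+n∣m⇒∣n (divides (p + q) (begin
  weight w₂ v + weight w₁ v            ≡⟨ cong₂ _+_ (weight≡occurrences w₂ refl v) (weight≡occurrences w₁ refl v) ⟩
  (1 * p + 2 * q) + (2 * p + 1 * q)    ≡⟨ solve 2 (λ p q → (con 1 :* p :+ con 2 :* q) :+ (con 2 :* p :+ con 1 :* q)
                                                         := (p :+ q) :* con 3) refl p q ⟩
  (p + q) * 3                          ∎)) (Γ⇒3∣weight-w₂ v Γv)
  where
    open ≡-Reasoning
    p q : ℕ
    p = occurrences 1₃ v
    q = occurrences 2₃ v

data Shape {m} (d : Vm m) : Set where
  zero-vector : d ≡ 𝟎 → Shape d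
  one-and-two : ∀ {i j} → i ≢ j → lookup d i ≡ 1₃ → lookup d j ≡ 2₃ → Shape d
  only-ones   : ∀ {i j} → i ≢ j → lookup d i ≡ 1₃ → lookup d j ≡ 1₃ →
                weight w₁ d ≡ 2 * weight w₂ d → 3 ≤ weight w₂ d → Shape d
  only-twos   : ∀ {i j} → i ≢ j → lookup d i ≡ 2₃ → lookup d j ≡ 2₃ →
                weight w₂ d ≡ 2 * weight w₁ d → 3 ≤ weight w₁ d → Shape d

shape : ∀ {m} (d : Vm m) → InΓ d → Shape d
shape d Γd = classify _ _ refl refl (subst (λ s → s mod 3 ≡ 0₃) (weight≡occurrences w₂ refl d) Γd)
  where
    weights : ∀ {p q} → occurrences 1₃ d ≡ p → occurrences 2₃ d ≡ q →
              weight w₁ d ≡ 2 * p + 1 * q × weight w₂ d ≡ 1 * p + 2 * q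
    weights refl refl = weight≡occurrences w₁ refl d , weight≡occurrences w₂ refl d

    classify : ∀ p q → occurrences 1₃ d ≡ p → occurrences 2₃ d ≡ q → (1 * p + 2 * q) mod 3 ≡ 0₃ → Shape d
    classify zero zero #1≡ #2≡ _ = zero-vector (weight-w₁≡0⇒𝟎 d (proj₁ (weights #1≡ #2≡)))
    classify (suc _) (suc _) #1≡ #2≡ _
      with i , dᵢ ← count≡suc⇒∃ (_≟ 1₃) d #1≡
         | j , dⱼ ← count≡suc⇒∃ (_≟ 2₃) d #2≡
      = one-and-two (λ { refl → 1≢2 (trans (sym dᵢ) dⱼ) }) dᵢ dⱼ
      where 1≢2 : 1₃ ≢ 2₃
            1≢2 ()
    classify 1 0 _ _ ()
    classify 2 0 _ _ ()
    classify 0 1 _ _ ()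
    classify 0 2 _ _ ()
    classify p@(suc (suc (suc _))) zero #1≡ #2≡ _
      with i , j , i≢j , dᵢ , dⱼ ← count≡2+⇒∃₂ (_≟ 1₃) d #1≡
         | W₁≡ , W₂≡ ← weights #1≡ #2≡
      = only-ones i≢j dᵢ dⱼ
          (trans W₁≡ (trans (solve 1 (λ p → con 2 :* p :+ con 1 :* con 0 := con 2 :* (con 1 :* p :+ con 2 :* con 0)) refl p)
                            (cong (2 *_) (sym W₂≡))))
          (subst (3 ≤_) (sym W₂≡) (s≤s (s≤s (s≤s z≤n))))
    classify zero q@(suc (suc (suc _))) #1≡ #2≡ _
      with i , j , i≢j , dᵢ , dⱼ ← count≡2+⇒∃₂ (_≟ 2₃) d #2≡
         | W₁≡ , W₂≡ ← weights #1≡ #2≡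
      = only-twos i≢j dᵢ dⱼ
          (trans W₂≡ (trans (solve 1 (λ q → con 1 :* con 0 :+ con 2 :* q := con 2 :* (con 2 :* con 0 :+ con 1 :* q)) refl q)
                            (cong (2 *_) (sym W₁≡))))
          (subst (3 ≤_) (sym W₁≡) (s≤s (s≤s (s≤s z≤n))))

m+[3+o]≡n+o∧n≤3[1+k]⇒m≤3k : ∀ {m n k} o → m + (3 + o) ≡ n + o → n ≤ 3 * suc k → m ≤ 3 * k
m+[3+o]≡n+o∧n≤3[1+k]⇒m≤3k {m} {n} {k} o eq n≤ = +-cancelˡ-≤ 3 m (3 * k) (+-cancelʳ-≤ o (3 + m) (3 + 3 * k) (begin
  3 + m + o      ≡⟨ cong (_+ o) (+-comm 3 m) ⟩
  m + 3 + o      ≡⟨ +-assoc m 3 o ⟩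
  m + (3 + o)    ≡⟨ eq ⟩
  n + o          ≤⟨ +-monoˡ-≤ o n≤ ⟩
  3 * suc k + o  ≡⟨ cong (_+ o) (*-suc 3 k) ⟩
  3 + 3 * k + o  ∎))
  where open ≤-Reasoning

3≤n∧2n≤3[1+k]⇒n≤3k : ∀ {n k} → 3 ≤ n → 2 * n ≤ 3 * suc k → n ≤ 3 * k
3≤n∧2n≤3[1+k]⇒n≤3k {n} {k} 3≤n 2n≤ = +-cancelˡ-≤ 3 n (3 * k) (begin
  3 + n        ≤⟨ +-monoˡ-≤ n 3≤n ⟩
  n + n        ≡⟨ cong (n +_) (+-identityʳ n) ⟨
  2 * n        ≤⟨ 2n≤ ⟩
  3 * suc k    ≡⟨ *-suc 3 k ⟩
  3 + 3 * k    ∎)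
  where open ≤-Reasoning

k∣m∧m<k*t⇒m≤k*pred[t] : ∀ {k m} t → k ∣ m → m < k * t → m ≤ k * pred t
k∣m∧m<k*t⇒m≤k*pred[t] {k} t (divides q refl) q*k<k*t = begin
  q * k       ≡⟨ *-comm q k ⟩
  k * q       ≤⟨ *-monoʳ-≤ k (<⇒≤pred (*-cancelˡ-< k q t (subst (_< k * t) (*-comm q k) q*k<k*t))) ⟩
  k * pred t  ∎
  where open ≤-Reasoning

xsum-within : ∀ k {m} (d : Vm m) → InΓ d → weight w₁ d ≤ 3 * k → weight w₂ d ≤ 3 * k →
              ∃[ l ] (l ≤ k × XSum l d)
xsum-within zero    d _  w₁≤0 _ = 0 , z≤n , subst (XSum 0) (sym (weight-w₁≡0⇒𝟎 d (n≤0⇒n≡0 w₁≤0))) []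
xsum-within (suc k) d Γd w₁≤ w₂≤ = descend (shape d Γd)
  where
    subtract : ∀ {i j} → i ≢ j → weight w₁ (d -ᵥ x i j) ≤ 3 * k → weight w₂ (d -ᵥ x i j) ≤ 3 * k →
               ∃[ l ] (l ≤ suc k × XSum l d)
    subtract {i} {j} i≢j b₁ b₂ with l , l≤k , s ← xsum-within k (d -ᵥ x i j) (Γ-[-ᵥx] d Γd i≢j) b₁ b₂
      = suc l , s≤s l≤k , i≢j ∷ s

    change : ∀ w {i j u v} → i ≢ j → lookup d i ≡ u → lookup d j ≡ v →
             weight w (d -ᵥ x i j) + (w u + w v) ≡ weight w d + (w (u ⊖ 1₃) + w (v ⊖ 2₃))
    change w i≢j refl refl = weight-[-ᵥx] w d i≢j

    descend : Shape d → ∃[ l ] (l ≤ suc k × XSum l d)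
    descend (zero-vector d≡𝟎) = 0 , z≤n , subst (XSum 0) (sym d≡𝟎) []
    descend (one-and-two i≢j dᵢ dⱼ) = subtract i≢j
      (m+[3+o]≡n+o∧n≤3[1+k]⇒m≤3k 0 (change w₁ i≢j dᵢ dⱼ) w₁≤)
      (m+[3+o]≡n+o∧n≤3[1+k]⇒m≤3k 0 (change w₂ i≢j dᵢ dⱼ) w₂≤)
    descend (only-ones i≢j dᵢ dⱼ w₁≡2w₂ 3≤w₂) = subtract i≢j
      (m+[3+o]≡n+o∧n≤3[1+k]⇒m≤3k 1 (change w₁ i≢j dᵢ dⱼ) w₁≤)
      (≤-trans (≤-reflexive (+-cancelʳ-≡ 2 _ _ (change w₂ i≢j dᵢ dⱼ)))
               (3≤n∧2n≤3[1+k]⇒n≤3k 3≤w₂ (subst (_≤ 3 * suc k) w₁≡2w₂ w₁≤)))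
    descend (only-twos i≢j dᵢ dⱼ w₂≡2w₁ 3≤w₁) = subtract i≢j
      (≤-trans (≤-reflexive (+-cancelʳ-≡ 2 _ _ (change w₁ i≢j dᵢ dⱼ)))
               (3≤n∧2n≤3[1+k]⇒n≤3k 3≤w₁ (subst (_≤ 3 * suc k) w₂≡2w₁ w₂≤)))
      (m+[3+o]≡n+o∧n≤3[1+k]⇒m≤3k 1 (change w₂ i≢j dᵢ dⱼ) w₂≤)

3n*2≡3*2n : ∀ n → 3 * n * 2 ≡ 3 * (2 * n)
3n*2≡3*2n n = trans (*-assoc 3 n 2) (cong (3 *_) (*-comm n 2))

2n≤xsum-length : ∀ w c → w 0₃ ≡ 0 → StepBounded w → w c ≡ 2 →
                 ∀ n {l} → XSum l (replicate (3 * n) c) → 2 * n ≤ l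
2n≤xsum-length w c w0≡0 bounded wc≡2 n {l} s = *-cancelˡ-≤ 3 (begin
  3 * (2 * n)                     ≡⟨ 3n*2≡3*2n n ⟨
  3 * n * 2                       ≡⟨ cong (3 * n *_) wc≡2 ⟨
  3 * n * w c                     ≡⟨ weight-replicate w (3 * n) c ⟨
  weight w (replicate (3 * n) c)  ≤⟨ weight-xsum≤ w w0≡0 bounded s ⟩
  3 * l                           ∎)
  where open ≤-Reasoning

weight≤3*pred[2n] : ∀ w c → (∀ a → a ≢ c → w a < w c) → w c ≡ 2 →
                    ∀ n (d : Vm (3 * n)) → 3 ∣ weight w d → d ≢ replicate _ c → weight w d ≤ 3 * pred (2 * n)
weight≤3*pred[2n] w c max wc≡2 n d 3∣ d≢c = k∣m∧m<k*t⇒m≤k*pred[t] (2 * n) 3∣ (begin-strict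
  weight w d   <⟨ weight<*max w c max d d≢c ⟩
  3 * n * w c  ≡⟨ cong (3 * n *_) wc≡2 ⟩
  3 * n * 2    ≡⟨ 3n*2≡3*2n n ⟩
  3 * (2 * n)  ∎)
  where open ≤-Reasoning

lemma3 : (n : ℕ) → 2 ≤ n → (y z : Vm (3 * n)) → InΓ y → InΓ z → y ≢ z →
    (AdjPow (2 * n ∸ 1) y z → ¬ (y ≈ z)) × (¬ (y ≈ z) → AdjPow (2 * n ∸ 1) y z)
lemma3 zero ()
lemma3 n@(suc _) _ y z Γy Γz y≢z = separated , joined
  where
    d : Vm (3 * n)
    d = y -ᵥ z

    Γd : InΓ d
    Γd = Γ-[-ᵥ] y z Γy Γz

    separated : AdjPow (2 * n ∸ 1) y z → ¬ (y ≈ z)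
    separated _                   (inj₁ d≡𝟎)         = y≢z (u-ᵥv≡𝟎⇒u≡v y z d≡𝟎)
    separated (_ , l , l≤ , walk) (inj₂ (inj₁ d≡𝐚)) = <⇒≱ (s≤s l≤)
      (2n≤xsum-length w₁ 1₃ refl w₁-step-bounded refl n (subst (XSum l) d≡𝐚 (walk⇒xsum walk)))
    separated (_ , l , l≤ , walk) (inj₂ (inj₂ d≡𝐛)) = <⇒≱ (s≤s l≤)
      (2n≤xsum-length w₂ 2₃ refl w₂-step-bounded refl n (subst (XSum l) d≡𝐛 (walk⇒xsum walk)))

    joined : ¬ (y ≈ z) → AdjPow (2 * n ∸ 1) y z
    joined y≉z with l , l≤ , s ← xsum-within (2 * n ∸ 1) d Γd
                      (weight≤3*pred[2n] w₁ 1₃ w₁<w₁1 refl n d (Γ⇒3∣weight-w₁ d Γd) (y≉z ∘ inj₂ ∘ inj₁))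
                      (weight≤3*pred[2n] w₂ 2₃ w₂<w₂2 refl n d (Γ⇒3∣weight-w₂ d Γd) (y≉z ∘ inj₂ ∘ inj₂))
      = y≢z , l , l≤ , xsum⇒walk Γy Γz s refl
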